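{- Let $p$ be a positive integer. (1) If $p$ is odd and $p\ge 5$, then $\mathrm{ex}(p+6,B_p)=(p+3)(p+5)/2$; (2) if $p$ is even and $p\notin\{2,6,10\}$, then $\mathrm{ex}(p+6,B_p)=1+(p+2)(p+6)/2$.
   Context: The book $B_p$ is the graph consisting of $p$ triangles sharing a common edge. For a graph $H$ and positive integer $n$, $\mathrm{ex}(n,H)$ is the maximum number of edges of a simple graph of order $n$ not containing $H$ as a subgraph. -}

module Defs where

open import Data.Nat using (ℕ; zero; suc; _+_; _≤_)
open import Data.Bool using (Bool; true; false; _∧_; if_then_else_)
open import Data.Fin using (Fin; toℕ; _<?_)
open import Data.Fin.Base using (zero; suc)
open import Data.List using (List; map; allFin)
open import Data.Nat.ListAction using (sum)
open import Data.Product using (Σ; _×_; _,_)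
open import Relation.Binary.PropositionalEquality using (_≡_)
open import Relation.Nullary.Decidable using (⌊_⌋)
open import Function.Definitions using (Injective)

record Graph (n : ℕ) : Set where
  field
    adj    : Fin n → Fin n → Bool
    sym    : ∀ i j → adj i j ≡ adj j i
    irrefl : ∀ i → adj i i ≡ false
open Graph public

edges : ∀ {n} → Graph n → ℕ
edges {n} G =
  sum (map (λ i → sum (map (λ j → if ⌊ i <? j ⌋ ∧ adj G i j then 1 else 0) (allFin n))) (allFin n))

Contains : ∀ {n m} → Graph n → Graph m → Set
Contains {n} {m} G H =
  Σ (Fin m → Fin n) λ f → Injective _≡_ _≡_ f × (∀ i j → adj H i j ≡ true → adj G (f i) (f j) ≡ true)

IsEx : ∀ {m} → ℕ → Graph m → ℕ → Set
IsEx {m} n H k =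
  (Σ (Graph n) λ G → (Contains G H → ⊥') × edges G ≡ k)
  × (∀ (G : Graph n) → (Contains G H → ⊥') → edges G ≤ k)
  where open import Data.Empty renaming (⊥ to ⊥')

-- The book B_p on vertex set Fin (2 + p): spine vertices 0 and 1,
-- pages 2, ..., p+1; edges 0-1 and {0,1}-k for every page k.
bookAdj : ∀ {p} → Fin (suc (suc p)) → Fin (suc (suc p)) → Bool
bookAdj zero zero = false
bookAdj zero (suc _) = true
bookAdj (suc zero) zero = true
bookAdj (suc zero) (suc zero) = false
bookAdj (suc zero) (suc (suc _)) = true
bookAdj (suc (suc _)) zero = true
bookAdj (suc (suc _)) (suc zero) = true
bookAdj (suc (suc _)) (suc (suc _)) = false

bookSym : ∀ {p} (i j : Fin (suc (suc p))) → bookAdj i j ≡ bookAdj j i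
bookSym zero zero = Relation.Binary.PropositionalEquality.refl
bookSym zero (suc zero) = Relation.Binary.PropositionalEquality.refl
bookSym zero (suc (suc _)) = Relation.Binary.PropositionalEquality.refl
bookSym (suc zero) zero = Relation.Binary.PropositionalEquality.refl
bookSym (suc zero) (suc zero) = Relation.Binary.PropositionalEquality.refl
bookSym (suc zero) (suc (suc _)) = Relation.Binary.PropositionalEquality.refl
bookSym (suc (suc _)) zero = Relation.Binary.PropositionalEquality.refl
bookSym (suc (suc _)) (suc zero) = Relation.Binary.PropositionalEquality.refl
bookSym (suc (suc _)) (suc (suc _)) = Relation.Binary.PropositionalEquality.refl

bookIrr : ∀ {p} (i : Fin (suc (suc p))) → bookAdj i i ≡ false
bookIrr zero = Relation.Binary.PropositionalEquality.refl
bookIrr (suc zero) = Relation.Binary.PropositionalEquality.refl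
bookIrr (suc (suc _)) = Relation.Binary.PropositionalEquality.refl

Book : (p : ℕ) → Graph (2 + p)
Book p = record { adj = bookAdj ; sym = bookSym ; irrefl = bookIrr }

-- Write nonDegree u for the number of non-neighbours of u, u itself included, so that a graph on
-- N = p + 6 vertices has 2e = N² − Σ nonDegree. In a B_p-free graph adjacent u, v have at most p − 1
-- common neighbours, and every vertex is a common neighbour or a non-neighbour of u or of v, so
-- nonDegree u + nonDegree v ≥ 7. Either some vertex has nonDegree ≤ 2 and all its neighbours have
-- nonDegree ≥ 5, or every nonDegree is ≥ 3 and the vertices with nonDegree 3 are pairwise
-- non-adjacent, hence at most three of them. Either way Σ nonDegree ≥ 4N − 3, i.e. 2e ≤ (p+3)(p+5).
--
-- Conversely, the complement of a graph H is B_p-free as soon as the closed neighbourhoods of any two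
-- non-adjacent vertices of H cover at least 7 vertices, and then 2e = N² − Σ |N_H[a]|. Take for H a
-- disjoint union of copies of K₄ and of a core: K₃ if N ≡ 3 (mod 4), K₃ + Petersen if N ≡ 1,
-- K₃ + W₇ if N ≡ 2 and K₃ + W₇ + Petersen if N ≡ 0, where W₇ is a 7-vertex graph whose closed
-- neighbourhoods have sizes 5, 4, …, 4. Then Σ |N_H[a]| is 4N − 3 for odd p and 4N − 2 for even p,
-- which matches the upper bound; the conditions on the four cores are checked by evaluation.

module Submission where

open import Defs renaming (sym to adj-sym; irrefl to adj-irrefl)
open import Data.Bool using (Bool; true; false; not; _∧_; _∨_; if_then_else_; T)
open import Data.Bool.ListAction using (any)
open import Data.Bool.Properties using (∧-identityʳ; ∨-comm; not-involutive; not-injective; T-≡) renaming (_≟_ to _≟ᵇ_)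
open import Data.Fin using (Fin; zero; suc; toℕ; _<?_)
import Data.Fin.Properties as Fin
open import Data.List using (List; []; _∷_; _++_; map; allFin; tabulate)
open import Data.List.Properties using (map-tabulate)
open import Data.Nat as ℕ using (ℕ; zero; suc; _+_; _*_; _∸_; _≤_; _<_; z≤n; s≤s; s≤s⁻¹; _≤?_; _≡ᵇ_; _<ᵇ_)
open import Data.Nat.Divisibility using (divides)
open import Data.Nat.DivMod using (_/_; _%_; m≡m%n+[m/n]*n; m%n<n; [m+kn]%n≡m%n; m/n*n≡m; m/n≡1+[m∸n]/n; m<n*o⇒m/o<n)
open import Data.Nat.ListAction using () renaming (sum to listSum)
open import Data.Nat.Properties hiding (_≟_; _<?_)
open import Data.Nat.Tactic.RingSolver using (solve-∀)
open import Algebra.Properties.Semiring.Sum +-*-semiring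
  using (sum; sum-syntax; sum-cong-≗; ∑-distrib-+; ∑-comm; *-distribˡ-sum)
open import Data.Product using (Σ-syntax; ∃₂; _×_; _,_; proj₁; proj₂)
open import Function using (_∘_; id)
open import Function.Bundles using (Equivalence)
open import Function.Definitions using (Injective)
open import Relation.Binary.Definitions using (tri<; tri≈; tri>)
open import Relation.Binary.PropositionalEquality
open import Relation.Nullary using (¬_; yes; no; contradiction)
open import Relation.Nullary.Decidable using (⌊_⌋; True; toWitness; _→-dec_)

χ : Bool → ℕ
χ b = if b then 1 else 0

T⇒≡true : ∀ {b} → T b → b ≡ true
T⇒≡true = Equivalence.to T-≡

≡true⇒T : ∀ {b} → b ≡ true → T b
≡true⇒T = Equivalence.from T-≡

≡ᵇ-true⇒≡ : ∀ {m n} → (m ≡ᵇ n) ≡ true → m ≡ n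
≡ᵇ-true⇒≡ {m} {n} = ≡ᵇ⇒≡ m n ∘ ≡true⇒T

sum-mono-≤ : ∀ {n} {f g : Fin n → ℕ} → (∀ i → f i ≤ g i) → sum f ≤ sum g
sum-mono-≤ {zero}  f≤g = z≤n
sum-mono-≤ {suc n} f≤g = +-mono-≤ (f≤g zero) (sum-mono-≤ (f≤g ∘ suc))

term≤sum : ∀ {n} (f : Fin n → ℕ) i → f i ≤ sum f
term≤sum f zero    = m≤m+n _ _
term≤sum f (suc i) = ≤-trans (term≤sum (f ∘ suc) i) (m≤n+m _ (f zero))

sum-const : ∀ n k → ∑[ i < n ] k ≡ n * k
sum-const zero    k = refl
sum-const (suc n) k = cong (k +_) (sum-const n k)

listSum-allFin : ∀ {n} (f : Fin n → ℕ) → listSum (map f (allFin n)) ≡ sum f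
listSum-allFin {n} f = trans (cong listSum (map-tabulate id f)) (listSum-tabulate f)
  where
  listSum-tabulate : ∀ {n} (f : Fin n → ℕ) → listSum (tabulate f) ≡ sum f
  listSum-tabulate {zero}  f = refl
  listSum-tabulate {suc n} f = cong (f zero +_) (listSum-tabulate (f ∘ suc))

count : ∀ {n} → (Fin n → Bool) → ℕ
count {n} P = ∑[ i < n ] χ (P i)

count-mono : ∀ {n} {P Q : Fin n → Bool} → (∀ i → P i ≡ true → Q i ≡ true) → count P ≤ count Q
count-mono P⇒Q = sum-mono-≤ λ i → χ-mono (P⇒Q i)
  where
  χ-mono : ∀ {a b} → (a ≡ true → b ≡ true) → χ a ≤ χ b
  χ-mono {false}         _   = z≤n
  χ-mono {true}  {true}  _   = ≤-refl
  χ-mono {true}  {false} a⇒b with () ← a⇒b refl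

-- Equality is tested on toℕ so that the test computes under suc.
remove : ∀ {n} → (Fin n → Bool) → Fin n → Fin n → Bool
remove P w v = P v ∧ not (toℕ v ≡ᵇ toℕ w)

count-remove : ∀ {n} (P : Fin n → Bool) w → P w ≡ true → count P ≡ suc (count (remove P w))
count-remove P zero Pw rewrite Pw =
  cong suc (sum-cong-≗ λ i → cong χ (sym (∧-identityʳ (P (suc i)))))
count-remove {suc n} P (suc w) Pw = begin
  χ (P zero) + count (P ∘ suc)          ≡⟨ cong (χ (P zero) +_) (count-remove (P ∘ suc) w Pw) ⟩
  χ (P zero) + (1 + rest)               ≡⟨ +-suc (χ (P zero)) rest ⟩
  1 + (χ (P zero) + rest)               ≡⟨ cong (λ b → 1 + (χ b + rest)) (sym (∧-identityʳ (P zero))) ⟩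
  1 + (χ (P zero ∧ true) + rest)        ∎
  where
  open ≡-Reasoning
  rest = count (remove (P ∘ suc) w)

distinct⇒≡ᵇ-false : ∀ {n} {a b : Fin n} → a ≢ b → (toℕ a ≡ᵇ toℕ b) ≡ false
distinct⇒≡ᵇ-false {a = a} {b} a≢b with toℕ a ≡ᵇ toℕ b in eq
... | false = refl
... | true  = contradiction (Fin.toℕ-injective (≡ᵇ-true⇒≡ {toℕ a} eq)) a≢b

injection⇒≤count : ∀ {n p} (P : Fin n → Bool) (g : Fin p → Fin n) → Injective _≡_ _≡_ g →
                   (∀ i → P (g i) ≡ true) → p ≤ count P
injection⇒≤count {p = zero}  P g g-inj Pg = z≤n
injection⇒≤count {p = suc p} P g g-inj Pg =
  subst (suc p ≤_) (sym (count-remove P (g zero) (Pg zero)))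
    (s≤s (injection⇒≤count (remove P (g zero)) (g ∘ suc) (Fin.suc-injective ∘ g-inj) P′g))
  where
  P′g : ∀ i → remove P (g zero) (g (suc i)) ≡ true
  P′g i = cong₂ _∧_ (Pg (suc i)) (cong not (distinct⇒≡ᵇ-false λ e → contradiction (g-inj e) λ ()))

≤count⇒injection : ∀ {n} p (P : Fin n → Bool) → p ≤ count P →
                   Σ[ g ∈ (Fin p → Fin n) ] Injective _≡_ _≡_ g × (∀ i → P (g i) ≡ true)
≤count⇒injection zero P _ = (λ ()) , (λ { {()} }) , (λ ())
≤count⇒injection {suc n} (suc p) P p<count with P zero in P0
... | false with g , g-inj , Pg ← ≤count⇒injection (suc p) (P ∘ suc) p<count =
  suc ∘ g , g-inj ∘ Fin.suc-injective , Pg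
... | true with g , g-inj , Pg ← ≤count⇒injection p (P ∘ suc) (s≤s⁻¹ p<count) =
  g′ , g′-inj , Pg′
  where
  g′ : Fin (suc p) → Fin (suc n)
  g′ zero    = zero
  g′ (suc i) = suc (g i)
  g′-inj : Injective _≡_ _≡_ g′
  g′-inj {zero}  {zero}  _ = refl
  g′-inj {suc i} {suc j} e = cong suc (g-inj (Fin.suc-injective e))
  Pg′ : ∀ i → P (g′ i) ≡ true
  Pg′ zero    = P0
  Pg′ (suc i) = Pg i

χ-trichotomy : ∀ {n} (i j : Fin n) b → (i ≡ j → b ≡ false) →
               χ b ≡ χ (⌊ i <? j ⌋ ∧ b) + χ (⌊ j <? i ⌋ ∧ b)
χ-trichotomy i j b i≡j⇒¬b with i <? j | j <? i
... | yes i<j | yes j<i = contradiction j<i (<-asym i<j)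
... | yes _   | no _    = sym (+-identityʳ (χ b))
... | no _    | yes _   = refl
... | no i≮j  | no j≮i with Fin.<-cmp i j
...   | tri< i<j _ _ = contradiction i<j i≮j
...   | tri> _ _ j<i = contradiction j<i j≮i
...   | tri≈ _ i≡j _ = cong χ (i≡j⇒¬b i≡j)

-- Non-degrees, common neighbours and books

∧-true : ∀ {a b} → (a ∧ b) ≡ true → a ≡ true × b ≡ true
∧-true {true} b≡true = refl , b≡true

module _ {n : ℕ} (G : Graph n) where

  degree : Fin n → ℕ
  degree u = count (adj G u)

  nonDegree : Fin n → ℕ
  nonDegree u = count (not ∘ adj G u)

  commonNeighbours : Fin n → Fin n → ℕ
  commonNeighbours u v = count (λ w → adj G u w ∧ adj G v w)

  degree+nonDegree : ∀ u → degree u + nonDegree u ≡ n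
  degree+nonDegree u = begin
    degree u + nonDegree u                          ≡⟨ sym (∑-distrib-+ (χ ∘ adj G u) (χ ∘ not ∘ adj G u)) ⟩
    ∑[ w < n ] (χ (adj G u w) + χ (not (adj G u w))) ≡⟨ sum-cong-≗ (χ+χ∘not ∘ adj G u) ⟩
    ∑[ w < n ] 1                                    ≡⟨ sum-const n 1 ⟩
    n * 1                                           ≡⟨ *-identityʳ n ⟩
    n                                               ∎
    where
    open ≡-Reasoning
    χ+χ∘not : ∀ b → χ b + χ (not b) ≡ 1
    χ+χ∘not true  = refl
    χ+χ∘not false = refl

  1≤nonDegree : ∀ u → 1 ≤ nonDegree u
  1≤nonDegree u = subst (λ b → χ (not b) ≤ nonDegree u) (adj-irrefl G u) (term≤sum _ u)

  private
    ordered : Fin n → Fin n → ℕ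
    ordered i j = χ (⌊ i <? j ⌋ ∧ adj G i j)

    χ-adj-split : ∀ i j → χ (adj G i j) ≡ ordered i j + ordered j i
    χ-adj-split i j = trans (χ-trichotomy i j (adj G i j) λ { refl → adj-irrefl G i })
                            (cong (λ b → ordered i j + χ (⌊ j <? i ⌋ ∧ b)) (adj-sym G i j))

    edges-ordered : edges G ≡ ∑[ i < n ] ∑[ j < n ] ordered i j
    edges-ordered = trans (listSum-allFin λ i → listSum (map (ordered i) (allFin n)))
                          (sum-cong-≗ λ i → listSum-allFin (ordered i))

  handshake : edges G + edges G ≡ sum degree
  handshake = begin
    edges G + edges G
      ≡⟨ cong₂ _+_ edges-ordered (trans edges-ordered (∑-comm ordered)) ⟩
    ∑[ i < n ] ∑[ j < n ] ordered i j + ∑[ i < n ] ∑[ j < n ] ordered j i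
      ≡⟨ sym (∑-distrib-+ (sum ∘ ordered) (λ i → ∑[ j < n ] ordered j i)) ⟩
    ∑[ i < n ] (∑[ j < n ] ordered i j + ∑[ j < n ] ordered j i)
      ≡⟨ sum-cong-≗ (λ i → sym (∑-distrib-+ (ordered i) (λ j → ordered j i))) ⟩
    ∑[ i < n ] ∑[ j < n ] (ordered i j + ordered j i)
      ≡⟨ sum-cong-≗ (λ i → sum-cong-≗ λ j → sym (χ-adj-split i j)) ⟩
    sum degree
      ∎
    where open ≡-Reasoning

  edges+edges+∑nonDegree : edges G + edges G + sum nonDegree ≡ n * n
  edges+edges+∑nonDegree = begin
    edges G + edges G + sum nonDegree  ≡⟨ cong (_+ sum nonDegree) handshake ⟩
    sum degree + sum nonDegree         ≡⟨ sym (∑-distrib-+ degree nonDegree) ⟩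
    ∑[ u < n ] (degree u + nonDegree u) ≡⟨ sum-cong-≗ degree+nonDegree ⟩
    ∑[ u < n ] n                       ≡⟨ sum-const n n ⟩
    n * n                              ∎
    where open ≡-Reasoning

  n≤common+nonDegree+nonDegree : ∀ u v → n ≤ commonNeighbours u v + nonDegree u + nonDegree v
  n≤common+nonDegree+nonDegree u v = begin
    n
      ≡⟨ sym (trans (sum-const n 1) (*-identityʳ n)) ⟩
    ∑[ w < n ] 1
      ≤⟨ sum-mono-≤ (λ w → covered (adj G u w) (adj G v w)) ⟩
    ∑[ w < n ] (χ (adj G u w ∧ adj G v w) + χ (not (adj G u w)) + χ (not (adj G v w)))
      ≡⟨ ∑-distrib-+ (λ w → χ (adj G u w ∧ adj G v w) + χ (not (adj G u w))) (χ ∘ not ∘ adj G v) ⟩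
    ∑[ w < n ] (χ (adj G u w ∧ adj G v w) + χ (not (adj G u w))) + nonDegree v
      ≡⟨ cong (_+ nonDegree v) (∑-distrib-+ (λ w → χ (adj G u w ∧ adj G v w)) (χ ∘ not ∘ adj G u)) ⟩
    commonNeighbours u v + nonDegree u + nonDegree v
      ∎
    where
    open ≤-Reasoning
    covered : ∀ a b → 1 ≤ χ (a ∧ b) + χ (not a) + χ (not b)
    covered true  true  = ≤-refl
    covered true  false = ≤-refl
    covered false b     = s≤s z≤n

  adj⇒≢ : ∀ {u v} → adj G u v ≡ true → u ≢ v
  adj⇒≢ {u} uv refl with () ← trans (sym uv) (adj-irrefl G u)

  book⇒spine : ∀ {p} → Contains G (Book p) →
               ∃₂ λ u v → adj G u v ≡ true × p ≤ commonNeighbours u v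
  book⇒spine {p} (f , f-inj , f-hom) =
    f zero , f (suc zero) , f-hom zero (suc zero) refl ,
    injection⇒≤count _ (λ i → f (suc (suc i))) (Fin.suc-injective ∘ Fin.suc-injective ∘ f-inj)
      (λ i → cong₂ _∧_ (f-hom zero (suc (suc i)) refl) (f-hom (suc zero) (suc (suc i)) refl))

  spine⇒book : ∀ {p} u v → adj G u v ≡ true → p ≤ commonNeighbours u v → Contains G (Book p)
  spine⇒book {p} u v uv p≤common with g , g-inj , g-common ← ≤count⇒injection p _ p≤common =
    f , f-inj , f-hom
    where
    ug : ∀ i → adj G u (g i) ≡ true
    ug i = proj₁ (∧-true (g-common i))
    vg : ∀ i → adj G v (g i) ≡ true
    vg i = proj₂ (∧-true (g-common i))
    f : Fin (2 + p) → Fin n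
    f zero          = u
    f (suc zero)    = v
    f (suc (suc i)) = g i
    f-hom : ∀ i j → adj (Book p) i j ≡ true → adj G (f i) (f j) ≡ true
    f-hom zero          (suc zero)    _ = uv
    f-hom zero          (suc (suc j)) _ = ug j
    f-hom (suc zero)    zero          _ = trans (adj-sym G v u) uv
    f-hom (suc zero)    (suc (suc j)) _ = vg j
    f-hom (suc (suc i)) zero          _ = trans (adj-sym G (g i) u) (ug i)
    f-hom (suc (suc i)) (suc zero)    _ = trans (adj-sym G (g i) v) (vg i)
    f-inj : Injective _≡_ _≡_ f
    f-inj {zero}          {zero}          _ = refl
    f-inj {suc zero}      {suc zero}      _ = refl
    f-inj {suc (suc i)}   {suc (suc j)}   e = cong (λ k → suc (suc k)) (g-inj e)
    f-inj {zero}          {suc zero}      e = contradiction e (adj⇒≢ uv)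
    f-inj {zero}          {suc (suc j)}   e = contradiction e (adj⇒≢ (ug j))
    f-inj {suc zero}      {zero}          e = contradiction (sym e) (adj⇒≢ uv)
    f-inj {suc zero}      {suc (suc j)}   e = contradiction e (adj⇒≢ (vg j))
    f-inj {suc (suc i)}   {zero}          e = contradiction (sym e) (adj⇒≢ (ug i))
    f-inj {suc (suc i)}   {suc zero}      e = contradiction (sym e) (adj⇒≢ (vg i))

-- The upper bound

bookFree⇒7≤nonDegree+nonDegree : ∀ p (G : Graph (p + 6)) → ¬ Contains G (Book p) →
                                 ∀ u v → adj G u v ≡ true → 7 ≤ nonDegree G u + nonDegree G v
bookFree⇒7≤nonDegree+nonDegree p G free u v uv with p ≤? commonNeighbours G u v
... | yes p≤c = contradiction (spine⇒book G u v uv p≤c) free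
... | no  p≰c = +-cancelˡ-≤ c 7 _ (begin
  c + 7                            ≡⟨ +-suc c 6 ⟩
  suc c + 6                        ≤⟨ +-monoˡ-≤ 6 (≰⇒> p≰c) ⟩
  p + 6                            ≤⟨ n≤common+nonDegree+nonDegree G u v ⟩
  c + nonDegree G u + nonDegree G v ≡⟨ +-assoc c _ _ ⟩
  c + (nonDegree G u + nonDegree G v) ∎)
  where
  open ≤-Reasoning
  c = commonNeighbours G u v

module _ {n : ℕ} (G : Graph n)
         (7≤nonDegree+nonDegree : ∀ u v → adj G u v ≡ true → 7 ≤ nonDegree G u + nonDegree G v) where

  private
    low : Fin n → Bool
    low w = ⌊ nonDegree G w ≤? 3 ⌋

    count-low≤3 : count low ≤ 3
    count-low≤3 with Fin.any? (λ u → nonDegree G u ≤? 3)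
    ... | yes (u , u-low) = ≤-trans (count-mono low⇒nonAdjacent) u-low
      where
      low⇒nonAdjacent : ∀ w → low w ≡ true → not (adj G u w) ≡ true
      low⇒nonAdjacent w lw with nonDegree G w ≤? 3 | adj G u w in uw
      ... | yes w-low | true  = contradiction (7≤nonDegree+nonDegree u w uw) (<⇒≱ (s≤s (+-mono-≤ u-low w-low)))
      ... | yes _     | false = refl
      ... | no  _     | _     with () ← lw
    ... | no none = begin
      count low     ≤⟨ count-mono {Q = λ _ → false} no-low ⟩
      ∑[ w < n ] 0  ≡⟨ sum-const n 0 ⟩
      n * 0         ≡⟨ *-zeroʳ n ⟩
      0             ≤⟨ z≤n ⟩
      3             ∎
      where
      open ≤-Reasoning
      no-low : ∀ w → low w ≡ true → false ≡ true
      no-low w lw with nonDegree G w ≤? 3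
      ... | yes w-low = contradiction (w , w-low) none
      ... | no  _     with () ← lw

  n*4≤∑nonDegree+3 : 5 ≤ n → n * 4 ≤ sum (nonDegree G) + 3
  n*4≤∑nonDegree+3 5≤n with Fin.any? (λ u → nonDegree G u ≤? 2)
  ... | yes (u , u≤2) = begin
    n * 4                                         ≡⟨ cong (_* 4) (sym (degree+nonDegree G u)) ⟩
    (d + nonDegree G u) * 4                       ≡⟨ *-distribʳ-+ 4 d (nonDegree G u) ⟩
    d * 4 + nonDegree G u * 4                     ≤⟨ +-monoʳ-≤ (d * 4) (*-monoˡ-≤ 4 u≤2) ⟩
    d * 4 + 8                                     ≤⟨ +-monoʳ-≤ (d * 4) (+-monoˡ-≤ 3 5≤n) ⟩
    d * 4 + (n + 3)                               ≡⟨ rearrange d n ⟩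
    n * 1 + 4 * d + 3
      ≡⟨ cong₂ (λ a b → a + b + 3) (sym (sum-const n 1)) (*-distribˡ-sum 4 (χ ∘ adj G u)) ⟩
    ∑[ w < n ] 1 + ∑[ w < n ] (4 * χ (adj G u w)) + 3
      ≡⟨ cong (_+ 3) (sym (∑-distrib-+ (λ _ → 1) (λ w → 4 * χ (adj G u w)))) ⟩
    ∑[ w < n ] (1 + 4 * χ (adj G u w)) + 3        ≤⟨ +-monoˡ-≤ 3 (sum-mono-≤ neighbours-far) ⟩
    sum (nonDegree G) + 3                         ∎
    where
    open ≤-Reasoning
    d = degree G u
    rearrange : ∀ d n → d * 4 + (n + 3) ≡ n * 1 + 4 * d + 3
    rearrange = solve-∀
    neighbours-far : ∀ w → 1 + 4 * χ (adj G u w) ≤ nonDegree G w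
    neighbours-far w with adj G u w in uw
    ... | false = 1≤nonDegree G w
    ... | true  = +-cancelˡ-≤ 2 5 _ (≤-trans (7≤nonDegree+nonDegree u w uw) (+-monoˡ-≤ _ u≤2))
  ... | no none = begin
    n * 4                                   ≡⟨ sym (sum-const n 4) ⟩
    ∑[ w < n ] 4                            ≤⟨ sum-mono-≤ 4≤nonDegree+χlow ⟩
    ∑[ w < n ] (nonDegree G w + χ (low w))  ≡⟨ ∑-distrib-+ (nonDegree G) (χ ∘ low) ⟩
    sum (nonDegree G) + count low           ≤⟨ +-monoʳ-≤ _ count-low≤3 ⟩
    sum (nonDegree G) + 3                   ∎
    where
    open ≤-Reasoning
    4≤nonDegree+χlow : ∀ w → 4 ≤ nonDegree G w + χ (low w)
    4≤nonDegree+χlow w with nonDegree G w ≤? 2 | nonDegree G w ≤? 3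
    ... | yes w≤2 | _       = contradiction (w , w≤2) none
    ... | no  w≰2 | yes _   = subst (4 ≤_) (+-comm 1 _) (s≤s (≰⇒> w≰2))
    ... | no  _   | no  w≰3 = ≤-trans (≰⇒> w≰3) (m≤m+n _ 0)

square-identity : ∀ p → (p + 6) * (p + 6) + 3 ≡ (p + 3) * (p + 5) + (p + 6) * 4
square-identity = solve-∀

bookFree⇒edges≤ : ∀ p (G : Graph (p + 6)) → ¬ Contains G (Book p) →
                  edges G + edges G ≤ (p + 3) * (p + 5)
bookFree⇒edges≤ p G free = +-cancelʳ-≤ (N * 4) _ _ (begin
  edges G + edges G + N * 4
    ≤⟨ +-monoʳ-≤ _ (n*4≤∑nonDegree+3 G (bookFree⇒7≤nonDegree+nonDegree p G free) 5≤N) ⟩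
  edges G + edges G + (sum (nonDegree G) + 3)    ≡⟨ sym (+-assoc (edges G + edges G) _ 3) ⟩
  edges G + edges G + sum (nonDegree G) + 3      ≡⟨ cong (_+ 3) (edges+edges+∑nonDegree G) ⟩
  N * N + 3                                      ≡⟨ square-identity p ⟩
  (p + 3) * (p + 5) + N * 4                      ∎)
  where
  open ≤-Reasoning
  N = p + 6
  5≤N : 5 ≤ N
  5≤N = ≤-trans (n≤1+n 5) (m≤n+m 6 p)

-- Complements of disjoint unions of a core and copies of K₄

sumBelow : ℕ → (ℕ → ℕ) → ℕ
sumBelow n f = ∑[ i < n ] f (toℕ i)

sumBelow-cong : ∀ n {f g : ℕ → ℕ} → (∀ {i} → i < n → f i ≡ g i) → sumBelow n f ≡ sumBelow n g
sumBelow-cong n f≡g = sum-cong-≗ λ i → f≡g (Fin.toℕ<n i)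

sumBelow-mono-≤ : ∀ n {f g : ℕ → ℕ} → (∀ {i} → i < n → f i ≤ g i) → sumBelow n f ≤ sumBelow n g
sumBelow-mono-≤ n f≤g = sum-mono-≤ λ i → f≤g (Fin.toℕ<n i)

sumBelow-+ : ∀ m n f → sumBelow (m + n) f ≡ sumBelow m f + sumBelow n (λ j → f (m + j))
sumBelow-+ zero    n f = refl
sumBelow-+ (suc m) n f = trans (cong (f 0 +_) (sumBelow-+ m n (f ∘ suc))) (sym (+-assoc (f 0) _ _))

sumBelow-zero : ∀ n {f : ℕ → ℕ} → (∀ {i} → i < n → f i ≡ 0) → sumBelow n f ≡ 0
sumBelow-zero n f≡0 = trans (sumBelow-cong n f≡0) (trans (sum-const n 0) (*-zeroʳ n))

closedDegree : (ℕ → ℕ → Bool) → ℕ → ℕ → ℕ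
closedDegree R N a = sumBelow N (λ x → χ (R a x))

closedUnion : (ℕ → ℕ → Bool) → ℕ → ℕ → ℕ → ℕ
closedUnion R N a b = sumBelow N (λ x → χ (R a x ∨ R b x))

module Complement (R : ℕ → ℕ → Bool) (R-sym : ∀ a b → R a b ≡ R b a) (R-refl : ∀ a → R a a ≡ true) where

  complement : (N : ℕ) → Graph N
  complement N = record
    { adj    = λ u v → not (R (toℕ u) (toℕ v))
    ; sym    = λ u v → cong not (R-sym (toℕ u) (toℕ v))
    ; irrefl = λ u → cong not (R-refl (toℕ u))
    }

  nonDegree-complement : ∀ {N} (u : Fin N) → nonDegree (complement N) u ≡ closedDegree R N (toℕ u)
  nonDegree-complement {N} u = sum-cong-≗ {N} λ w → cong χ (not-involutive (R (toℕ u) (toℕ w)))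

  edges-complement : ∀ N → edges (complement N) + edges (complement N) + sumBelow N (closedDegree R N) ≡ N * N
  edges-complement N =
    trans (cong (edges (complement N) + edges (complement N) +_) (sym (sum-cong-≗ {N} nonDegree-complement)))
          (edges+edges+∑nonDegree (complement N))

  common+closedUnion : ∀ {N} (u v : Fin N) →
                       commonNeighbours (complement N) u v + closedUnion R N (toℕ u) (toℕ v) ≡ N
  common+closedUnion {N} u v = begin
    commonNeighbours (complement N) u v + closedUnion R N a b
      ≡⟨ sym (∑-distrib-+ {N} (λ x → χ (not (R a (toℕ x)) ∧ not (R b (toℕ x))))
                              (λ x → χ (R a (toℕ x) ∨ R b (toℕ x)))) ⟩
    ∑[ x < N ] (χ (not (R a (toℕ x)) ∧ not (R b (toℕ x))) + χ (R a (toℕ x) ∨ R b (toℕ x)))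
      ≡⟨ sum-cong-≗ {N} (λ x → de-morgan (R a (toℕ x)) (R b (toℕ x))) ⟩
    ∑[ x < N ] 1
      ≡⟨ trans (sum-const N 1) (*-identityʳ N) ⟩
    N ∎
    where
    open ≡-Reasoning
    a = toℕ u
    b = toℕ v
    de-morgan : ∀ x y → χ (not x ∧ not y) + χ (x ∨ y) ≡ 1
    de-morgan true  _     = refl
    de-morgan false true  = refl
    de-morgan false false = refl

  complement-bookFree : ∀ {N} p → p + 6 ≡ N →
                        (∀ {a b} → a < N → b < N → R a b ≡ false → 7 ≤ closedUnion R N a b) →
                        ¬ Contains (complement N) (Book p)
  complement-bookFree {N} p p+6≡N 7≤closedUnion book with u , v , uv , p≤common ← book⇒spine (complement N) book =
    <-irrefl refl (+-cancelˡ-≤ p 7 6 (begin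
      p + 7                                                   ≤⟨ +-mono-≤ p≤common 7≤union ⟩
      commonNeighbours (complement N) u v + closedUnion R N (toℕ u) (toℕ v) ≡⟨ common+closedUnion u v ⟩
      N                                                       ≡⟨ sym p+6≡N ⟩
      p + 6                                                   ∎))
    where
    open ≤-Reasoning
    7≤union : 7 ≤ closedUnion R N (toℕ u) (toℕ v)
    7≤union = 7≤closedUnion (Fin.toℕ<n u) (Fin.toℕ<n v) (not-injective {y = false} uv)

≡ᵇ-refl : ∀ m → (m ≡ᵇ m) ≡ true
≡ᵇ-refl m = T⇒≡true (≡⇒≡ᵇ m m refl)

≡ᵇ-false⇒≢ : ∀ {m n} → (m ≡ᵇ n) ≡ false → m ≢ n
≡ᵇ-false⇒≢ {m} m≢n refl with () ← trans (sym (≡ᵇ-refl m)) m≢n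

≡ᵇ-sym : ∀ m n → (m ≡ᵇ n) ≡ (n ≡ᵇ m)
≡ᵇ-sym zero    zero    = refl
≡ᵇ-sym zero    (suc n) = refl
≡ᵇ-sym (suc m) zero    = refl
≡ᵇ-sym (suc m) (suc n) = ≡ᵇ-sym m n

<ᵇ-true : ∀ {m n} → m < n → (m <ᵇ n) ≡ true
<ᵇ-true m<n = T⇒≡true (<⇒<ᵇ m<n)

<ᵇ-false : ∀ {m n} → n ≤ m → (m <ᵇ n) ≡ false
<ᵇ-false {m} {n} n≤m with m <ᵇ n in m<ᵇn
... | false = refl
... | true  = contradiction (<ᵇ⇒< m n (≡true⇒T m<ᵇn)) (≤⇒≯ n≤m)

χ≤χ∨ˡ : ∀ a b → χ a ≤ χ (a ∨ b)
χ≤χ∨ˡ true  _ = ≤-refl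
χ≤χ∨ˡ false _ = z≤n

χ≤χ∨ʳ : ∀ a b → χ b ≤ χ (a ∨ b)
χ≤χ∨ʳ true  true  = ≤-refl
χ≤χ∨ʳ true  false = z≤n
χ≤χ∨ʳ false _     = ≤-refl

χ+χ≤χ∨-≡ᵇ : ∀ {m n} → (m ≡ᵇ n) ≡ false →
            ∀ z → χ (m ≡ᵇ z) + χ (n ≡ᵇ z) ≤ χ ((m ≡ᵇ z) ∨ (n ≡ᵇ z))
χ+χ≤χ∨-≡ᵇ {m} {n} m≢n z with m ≡ᵇ z in m≡z | n ≡ᵇ z in n≡z
... | false | _     = ≤-refl
... | true  | false = ≤-refl
... | true  | true  = contradiction (trans (≡ᵇ-true⇒≡ {m} m≡z) (sym (≡ᵇ-true⇒≡ {n} n≡z))) (≡ᵇ-false⇒≢ {m} m≢n)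

[4+j]/4≡1+j/4 : ∀ j → (4 + j) / 4 ≡ suc (j / 4)
[4+j]/4≡1+j/4 j = m/n≡1+[m∸n]/n (m≤m+n 4 j)

sameBlock-count : ∀ t q → sumBelow (t * 4) (λ j → χ (q ≡ᵇ j / 4)) ≡ 4 * χ (q <ᵇ t)
sameBlock-count zero    q       = refl
sameBlock-count (suc t) zero    =
  cong (4 +_) (sumBelow-zero (t * 4) λ {j} _ → cong (λ k → χ (0 ≡ᵇ k)) ([4+j]/4≡1+j/4 j))
sameBlock-count (suc t) (suc q) =
  trans (sumBelow-cong (t * 4) λ {j} _ → cong (λ k → χ (suc q ≡ᵇ k)) ([4+j]/4≡1+j/4 j)) (sameBlock-count t q)

listed : List (ℕ × ℕ) → ℕ → ℕ → Bool
listed es a b = any (λ e → (a ≡ᵇ proj₁ e) ∧ (b ≡ᵇ proj₂ e)) es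

linked : List (ℕ × ℕ) → ℕ → ℕ → Bool
linked es a b = (a ≡ᵇ b) ∨ (listed es a b ∨ listed es b a)

linked-sym : ∀ es a b → linked es a b ≡ linked es b a
linked-sym es a b = cong₂ _∨_ (≡ᵇ-sym a b) (∨-comm (listed es a b) (listed es b a))

linked-refl : ∀ es a → linked es a a ≡ true
linked-refl es a = cong (_∨ (listed es a a ∨ listed es a a)) (≡ᵇ-refl a)

record Core (deficit : ℕ) : Set where
  field
    size       : ℕ
    edgeList   : List (ℕ × ℕ)
    3≤degree   : ∀ {a} → a < size → 3 ≤ closedDegree (linked edgeList) size a
    7≤union    : ∀ {a} → a < size → ∀ {b} → b < size → linked edgeList a b ≡ false →
                 7 ≤ closedUnion (linked edgeList) size a b
    degree-sum : sumBelow size (closedDegree (linked edgeList) size) + deficit ≡ size * 4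

-- A B_p-free graph on p + 6 vertices whose non-degrees sum to 4(p + 6) − k.
BookFreeWithDeficit : ℕ → ℕ → Set
BookFreeWithDeficit p k =
  Σ[ G ∈ Graph (p + 6) ] ¬ Contains G (Book p) × edges G + edges G + (p + 6) * 4 ≡ (p + 6) * (p + 6) + k

module CoreWithBlocks {k : ℕ} (C : Core k) where
  open Core C renaming (size to c)

  core : ℕ → ℕ → Bool
  core = linked edgeList

  block : ℕ → ℕ
  block a = (a ∸ c) / 4

  -- Vertices below c carry the core; vertex c + j lies in the (j / 4)-th copy of K₄.
  close : ℕ → ℕ → Bool
  close a b = if a <ᵇ c then (b <ᵇ c) ∧ core a b else not (b <ᵇ c) ∧ (block a ≡ᵇ block b)

  close-sym : ∀ a b → close a b ≡ close b a
  close-sym a b with a <ᵇ c | b <ᵇ c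
  ... | true  | true  = linked-sym edgeList a b
  ... | true  | false = refl
  ... | false | true  = refl
  ... | false | false = ≡ᵇ-sym (block a) (block b)

  close-refl : ∀ a → close a a ≡ true
  close-refl a with a <ᵇ c
  ... | true  = linked-refl edgeList a
  ... | false = ≡ᵇ-refl (block a)

  close-core : ∀ {a b} → a < c → b < c → close a b ≡ core a b
  close-core a<c b<c rewrite <ᵇ-true a<c | <ᵇ-true b<c = refl

  close-core-block : ∀ {a} j → a < c → close a (c + j) ≡ false
  close-core-block j a<c rewrite <ᵇ-true a<c | <ᵇ-false (m≤m+n c j) = refl

  close-block-core : ∀ {a} j → a < c → close (c + j) a ≡ false
  close-block-core {a} j a<c = trans (close-sym (c + j) a) (close-core-block j a<c)

  close-block-block : ∀ i j → close (c + i) (c + j) ≡ (i / 4 ≡ᵇ j / 4)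
  close-block-block i j
    rewrite <ᵇ-false (m≤m+n c i) | <ᵇ-false (m≤m+n c j) | m+n∸m≡n c i | m+n∸m≡n c j = refl

  open Complement close close-sym close-refl

  module _ (t : ℕ) where

    N : ℕ
    N = c + t * 4

    data Position : ℕ → Set where
      core-vertex  : ∀ {a} → a < c → Position a
      block-vertex : ∀ j → j < t * 4 → Position (c + j)

    position : ∀ {a} → a < N → Position a
    position {a} a<N with a ℕ.<? c
    ... | yes a<c = core-vertex a<c
    ... | no  a≮c = subst Position (m+[n∸m]≡n c≤a)
                      (block-vertex (a ∸ c) (+-cancelˡ-< c _ _ (subst (_< N) (sym (m+[n∸m]≡n c≤a)) a<N)))
      where
      c≤a : c ≤ a
      c≤a = ≮⇒≥ a≮c

    split : ∀ f → sumBelow N f ≡ sumBelow c f + sumBelow (t * 4) (λ j → f (c + j))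
    split = sumBelow-+ c (t * 4)

    blockDegree : ∀ {j} → j < t * 4 → sumBelow (t * 4) (λ i → χ (j / 4 ≡ᵇ i / 4)) ≡ 4
    blockDegree {j} j<4t =
      trans (sameBlock-count t (j / 4)) (cong (λ b → 4 * χ b) (<ᵇ-true (m<n*o⇒m/o<n {j} {t} {4} j<4t)))

    closedDegree-core : ∀ {a} → a < c → closedDegree close N a ≡ closedDegree core c a
    closedDegree-core {a} a<c = begin
      closedDegree close N a                                          ≡⟨ split (χ ∘ close a) ⟩
      closedDegree close c a + sumBelow (t * 4) (λ j → χ (close a (c + j)))
        ≡⟨ cong₂ _+_ (sumBelow-cong c λ x<c → cong χ (close-core a<c x<c))
                     (sumBelow-zero (t * 4) λ {j} _ → cong χ (close-core-block j a<c)) ⟩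
      closedDegree core c a + 0                                       ≡⟨ +-identityʳ _ ⟩
      closedDegree core c a                                           ∎
      where open ≡-Reasoning

    closedDegree-block : ∀ {j} → j < t * 4 → closedDegree close N (c + j) ≡ 4
    closedDegree-block {j} j<4t = begin
      closedDegree close N (c + j)                                    ≡⟨ split (χ ∘ close (c + j)) ⟩
      closedDegree close c (c + j) + sumBelow (t * 4) (λ i → χ (close (c + j) (c + i)))
        ≡⟨ cong₂ _+_ (sumBelow-zero c λ x<c → cong χ (close-block-core j x<c))
                     (sumBelow-cong (t * 4) λ {i} _ → cong χ (close-block-block j i)) ⟩
      0 + sumBelow (t * 4) (λ i → χ (j / 4 ≡ᵇ i / 4))                 ≡⟨ blockDegree j<4t ⟩
      4                                                               ∎
      where open ≡-Reasoning

    closedDegree-sum : sumBelow N (closedDegree close N) + k ≡ N * 4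
    closedDegree-sum = begin
      sumBelow N D + k                                                  ≡⟨ cong (_+ k) (split D) ⟩
      sumBelow c D + sumBelow (t * 4) (λ j → D (c + j)) + k
        ≡⟨ cong (λ s → s + k) (cong₂ _+_ (sumBelow-cong c closedDegree-core) (sumBelow-cong (t * 4) closedDegree-block)) ⟩
      sumBelow c (closedDegree core c) + sumBelow (t * 4) (λ _ → 4) + k
        ≡⟨ rearrange (sumBelow c (closedDegree core c)) (sumBelow (t * 4) (λ _ → 4)) k ⟩
      sumBelow c (closedDegree core c) + k + sumBelow (t * 4) (λ _ → 4)  ≡⟨ cong₂ _+_ degree-sum (sum-const (t * 4) 4) ⟩
      c * 4 + t * 4 * 4                                                 ≡⟨ sym (*-distribʳ-+ 4 c (t * 4)) ⟩
      N * 4                                                             ∎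
      where
      open ≡-Reasoning
      D = closedDegree close N
      rearrange : ∀ x y z → x + y + z ≡ x + z + y
      rearrange = solve-∀

    private
      U₁ U₂ : ℕ → ℕ → ℕ
      U₁ a b = closedUnion close c a b
      U₂ a b = sumBelow (t * 4) (λ j → χ (close a (c + j) ∨ close b (c + j)))

      closedUnion-split : ∀ a b → closedUnion close N a b ≡ U₁ a b + U₂ a b
      closedUnion-split a b = split (λ x → χ (close a x ∨ close b x))

      closedUnion-sym : ∀ a b → closedUnion close N a b ≡ closedUnion close N b a
      closedUnion-sym a b = sumBelow-cong N λ {x} _ → cong χ (∨-comm (close a x) (close b x))

      7≤closedUnion-core-block : ∀ {a} j → a < c → j < t * 4 → 7 ≤ closedUnion close N a (c + j)
      7≤closedUnion-core-block {a} j a<c j<4t = begin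
        3 + 4                                     ≤⟨ +-mono-≤ (3≤degree a<c) (≤-reflexive (sym (blockDegree j<4t))) ⟩
        closedDegree core c a + sumBelow (t * 4) (λ i → χ (j / 4 ≡ᵇ i / 4))
          ≤⟨ +-mono-≤ (sumBelow-mono-≤ c λ {x} x<c →
                         subst (_≤ χ (close a x ∨ close (c + j) x)) (cong χ (close-core a<c x<c)) (χ≤χ∨ˡ _ _))
                      (sumBelow-mono-≤ (t * 4) λ {i} _ →
                         subst (_≤ χ (close a (c + i) ∨ close (c + j) (c + i)))
                               (cong χ (close-block-block j i)) (χ≤χ∨ʳ _ _)) ⟩
        U₁ a (c + j) + U₂ a (c + j)               ≡⟨ sym (closedUnion-split a (c + j)) ⟩
        closedUnion close N a (c + j)             ∎
        where open ≤-Reasoning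

      7≤closedUnion-core-core : ∀ {a b} → a < c → b < c → core a b ≡ false → 7 ≤ closedUnion close N a b
      7≤closedUnion-core-core {a} {b} a<c b<c ab = begin
        7                            ≤⟨ 7≤union a<c b<c ab ⟩
        closedUnion core c a b
          ≡⟨ sumBelow-cong c (λ x<c → sym (cong₂ (λ u v → χ (u ∨ v)) (close-core a<c x<c) (close-core b<c x<c))) ⟩
        U₁ a b                       ≤⟨ m≤m+n (U₁ a b) (U₂ a b) ⟩
        U₁ a b + U₂ a b              ≡⟨ sym (closedUnion-split a b) ⟩
        closedUnion close N a b      ∎
        where open ≤-Reasoning

      7≤closedUnion-block-block : ∀ i j → i < t * 4 → j < t * 4 → (i / 4 ≡ᵇ j / 4) ≡ false →
                                  7 ≤ closedUnion close N (c + i) (c + j)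
      7≤closedUnion-block-block i j i<4t j<4t ij = begin
        7                                                  ≤⟨ n≤1+n 7 ⟩
        4 + 4                                              ≡⟨ sym (cong₂ _+_ (blockDegree i<4t) (blockDegree j<4t)) ⟩
        sumBelow (t * 4) (λ x → χ (i / 4 ≡ᵇ x / 4)) + sumBelow (t * 4) (λ x → χ (j / 4 ≡ᵇ x / 4))
          ≡⟨ sym (∑-distrib-+ {t * 4} (λ x → χ (i / 4 ≡ᵇ toℕ x / 4)) (λ x → χ (j / 4 ≡ᵇ toℕ x / 4))) ⟩
        sumBelow (t * 4) (λ x → χ (i / 4 ≡ᵇ x / 4) + χ (j / 4 ≡ᵇ x / 4))
          ≤⟨ sumBelow-mono-≤ (t * 4) (λ {x} _ → χ+χ≤χ∨-≡ᵇ {i / 4} {j / 4} ij (x / 4)) ⟩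
        sumBelow (t * 4) (λ x → χ ((i / 4 ≡ᵇ x / 4) ∨ (j / 4 ≡ᵇ x / 4)))
          ≡⟨ sumBelow-cong (t * 4) (λ {x} _ →
               sym (cong₂ (λ u v → χ (u ∨ v)) (close-block-block i x) (close-block-block j x))) ⟩
        U₂ (c + i) (c + j)                                 ≤⟨ m≤n+m (U₂ (c + i) (c + j)) (U₁ (c + i) (c + j)) ⟩
        U₁ (c + i) (c + j) + U₂ (c + i) (c + j)            ≡⟨ sym (closedUnion-split (c + i) (c + j)) ⟩
        closedUnion close N (c + i) (c + j)                ∎
        where open ≤-Reasoning

    7≤closedUnion : ∀ {a b} → a < N → b < N → close a b ≡ false → 7 ≤ closedUnion close N a b
    7≤closedUnion a<N b<N = cases (position a<N) (position b<N)
      where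
      cases : ∀ {a b} → Position a → Position b → close a b ≡ false → 7 ≤ closedUnion close N a b
      cases (core-vertex a<c)      (core-vertex b<c)      ab =
        7≤closedUnion-core-core a<c b<c (trans (sym (close-core a<c b<c)) ab)
      cases (core-vertex a<c)      (block-vertex j j<4t) _  = 7≤closedUnion-core-block j a<c j<4t
      cases (block-vertex i i<4t) (core-vertex b<c)      _  =
        subst (7 ≤_) (closedUnion-sym _ (c + i)) (7≤closedUnion-core-block i b<c i<4t)
      cases (block-vertex i i<4t) (block-vertex j j<4t) ij =
        7≤closedUnion-block-block i j i<4t j<4t (trans (sym (close-block-block i j)) ij)

    lowerBound : ∀ p → p + 6 ≡ N → BookFreeWithDeficit p k
    lowerBound p p+6≡N =
      subst (λ M → Σ[ G ∈ Graph M ] ¬ Contains G (Book p) × edges G + edges G + M * 4 ≡ M * M + k) (sym p+6≡N)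
        (complement N , complement-bookFree p p+6≡N 7≤closedUnion , edges-count)
      where
      open ≡-Reasoning
      e = edges (complement N)
      edges-count : e + e + N * 4 ≡ N * N + k
      edges-count = begin
        e + e + N * 4                                   ≡⟨ cong (e + e +_) (sym closedDegree-sum) ⟩
        e + e + (sumBelow N (closedDegree close N) + k) ≡⟨ sym (+-assoc (e + e) _ k) ⟩
        e + e + sumBelow N (closedDegree close N) + k   ≡⟨ cong (_+ k) (edges-complement N) ⟩
        N * N + k                                       ∎

verifiedCore : ∀ c es k →
  True (allUpTo? (λ a → 3 ≤? closedDegree (linked es) c a) c) →
  True (allUpTo? (λ a → allUpTo? (λ b → (linked es a b ≟ᵇ false) →-dec (7 ≤? closedUnion (linked es) c a b)) c) c) →
  sumBelow c (closedDegree (linked es) c) + k ≡ c * 4 →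
  Core k
verifiedCore c es k degrees unions total = record
  { size       = c
  ; edgeList   = es
  ; 3≤degree   = toWitness degrees
  ; 7≤union    = toWitness unions
  ; degree-sum = total
  }

shift : ℕ → List (ℕ × ℕ) → List (ℕ × ℕ)
shift k = map λ (x , y) → (k + x , k + y)

triangle : List (ℕ × ℕ)
triangle = (0 , 1) ∷ (0 , 2) ∷ (1 , 2) ∷ []

petersen : List (ℕ × ℕ)
petersen =
  (0 , 1) ∷ (1 , 2) ∷ (2 , 3) ∷ (3 , 4) ∷ (4 , 0) ∷
  (0 , 5) ∷ (1 , 6) ∷ (2 , 7) ∷ (3 , 8) ∷ (4 , 9) ∷
  (5 , 7) ∷ (7 , 9) ∷ (9 , 6) ∷ (6 , 8) ∷ (8 , 5) ∷ []

W₇ : List (ℕ × ℕ)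
W₇ =
  (0 , 1) ∷ (0 , 2) ∷ (1 , 2) ∷ (0 , 3) ∷ (0 , 4) ∷ (3 , 4) ∷
  (1 , 5) ∷ (2 , 5) ∷ (3 , 6) ∷ (4 , 6) ∷ (5 , 6) ∷ []

K₃ : Core 3
K₃ = verifiedCore 3 triangle 3 _ _ refl

K₃+Petersen : Core 3
K₃+Petersen = verifiedCore 13 (triangle ++ shift 3 petersen) 3 _ _ refl

K₃+W₇ : Core 2
K₃+W₇ = verifiedCore 10 (triangle ++ shift 3 W₇) 2 _ _ refl

K₃+W₇+Petersen : Core 2
K₃+W₇+Petersen = verifiedCore 20 (triangle ++ shift 3 W₇ ++ shift 10 petersen) 2 _ _ refl

[r+q*4]%2≡r%2 : ∀ r q → (r + q * 4) % 2 ≡ r % 2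
[r+q*4]%2≡r%2 r q = trans (cong (λ m → (r + m) % 2) (q*4≡q*2*2 q)) ([m+kn]%n≡m%n r (q * 2) 2)
  where
  q*4≡q*2*2 : ∀ q → q * 4 ≡ q * 2 * 2
  q*4≡q*2*2 = solve-∀

construction-odd : ∀ p → p % 2 ≡ 1 → 5 ≤ p → BookFreeWithDeficit p 3
construction-odd p odd 5≤p with p / 4 | p % 4 | m%n<n p 4 | m≡m%n+[m/n]*n p 4
... | q     | 0 | _ | refl = contradiction (trans (sym ([r+q*4]%2≡r%2 0 q)) odd) λ ()
... | q     | 2 | _ | refl = contradiction (trans (sym ([r+q*4]%2≡r%2 2 q)) odd) λ ()
... | zero  | 1 | _ | refl with s≤s () ← 5≤p
... | zero  | 3 | _ | refl with s≤s (s≤s (s≤s ())) ← 5≤p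
... | suc q | 1 | _ | refl = CoreWithBlocks.lowerBound K₃ (2 + q) _ (size q)
  where
  size : ∀ q → 1 + suc q * 4 + 6 ≡ 3 + (2 + q) * 4
  size = solve-∀
... | suc q | 3 | _ | refl = CoreWithBlocks.lowerBound K₃+Petersen q _ (size q)
  where
  size : ∀ q → 3 + suc q * 4 + 6 ≡ 13 + q * 4
  size = solve-∀
... | _ | suc (suc (suc (suc _))) | s≤s (s≤s (s≤s (s≤s ()))) | _

construction-even : ∀ p → p % 2 ≡ 0 → 1 ≤ p → p ≢ 2 → p ≢ 6 → p ≢ 10 → BookFreeWithDeficit p 2
construction-even p even 1≤p p≢2 p≢6 p≢10 with p / 4 | p % 4 | m%n<n p 4 | m≡m%n+[m/n]*n p 4
... | q     | 1 | _ | refl = contradiction (trans (sym ([r+q*4]%2≡r%2 1 q)) even) λ ()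
... | q     | 3 | _ | refl = contradiction (trans (sym ([r+q*4]%2≡r%2 3 q)) even) λ ()
... | zero  | 0 | _ | refl with () ← 1≤p
... | 0     | 2 | _ | refl = contradiction refl p≢2
... | 1     | 2 | _ | refl = contradiction refl p≢6
... | 2     | 2 | _ | refl = contradiction refl p≢10
... | suc q | 0 | _ | refl = CoreWithBlocks.lowerBound K₃+W₇ q _ (size q)
  where
  size : ∀ q → 0 + suc q * 4 + 6 ≡ 10 + q * 4
  size = solve-∀
... | suc (suc (suc q)) | 2 | _ | refl = CoreWithBlocks.lowerBound K₃+W₇+Petersen q _ (size q)
  where
  size : ∀ q → 2 + suc (suc (suc q)) * 4 + 6 ≡ 20 + q * 4
  size = solve-∀
... | _ | suc (suc (suc (suc _))) | s≤s (s≤s (s≤s (s≤s ()))) | _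

isEx-from-doubled-bounds : ∀ {N m} (H : Graph m) k →
  (∀ (G : Graph N) → ¬ Contains G H → edges G + edges G ≤ suc (k * 2)) →
  (Σ[ G ∈ Graph N ] ¬ Contains G H × edges G + edges G ≡ k * 2) →
  IsEx N H k
isEx-from-doubled-bounds H k upper (G , free , G-edges) =
  (G , free , halve G-edges) , λ G′ free′ → halve-≤ (upper G′ free′)
  where
  e+e≡e*2 : ∀ e → e + e ≡ e * 2
  e+e≡e*2 = solve-∀
  halve : ∀ {e} → e + e ≡ k * 2 → e ≡ k
  halve {e} e+e≡k*2 = *-cancelʳ-≡ e k 2 (trans (sym (e+e≡e*2 e)) e+e≡k*2)
  halve-≤ : ∀ {e} → e + e ≤ suc (k * 2) → e ≤ k
  halve-≤ {e} e+e≤ with e ≤? k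
  ... | yes e≤k = e≤k
  ... | no  e≰k = contradiction (≤-trans (+-mono-≤ (≰⇒> e≰k) (≰⇒> e≰k)) e+e≤) (<⇒≱ (≤-reflexive (2+2k k)))
    where
    2+2k : ∀ k → suc (suc (k * 2)) ≡ suc k + suc k
    2+2k = solve-∀

isEx-Book : ∀ p K k → (p + 3) * (p + 5) ≤ suc (K * 2) → (p + 6) * (p + 6) + k ≡ K * 2 + (p + 6) * 4 →
            BookFreeWithDeficit p k → IsEx (p + 6) (Book p) K
isEx-Book p K k upper deficit (G , free , G-edges) =
  isEx-from-doubled-bounds (Book p) K (λ G′ free′ → ≤-trans (bookFree⇒edges≤ p G′ free′) upper)
    (G , free , +-cancelʳ-≡ ((p + 6) * 4) _ _ (trans G-edges deficit))

p≡r+h*2 : ∀ p {r} → p % 2 ≡ r → p ≡ r + p / 2 * 2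
p≡r+h*2 p p%2≡r = trans (m≡m%n+[m/n]*n p 2) (cong (_+ p / 2 * 2) p%2≡r)

ex-odd : ∀ p → p % 2 ≡ 1 → 5 ≤ p → IsEx (p + 6) (Book p) (((p + 3) * (p + 5)) / 2)
ex-odd p odd 5≤p = isEx-Book p (X / 2) 3
  (≤-trans (≤-reflexive (sym X/2*2≡X)) (n≤1+n _))
  (trans (square-identity p) (cong (_+ (p + 6) * 4) (sym X/2*2≡X)))
  (construction-odd p odd 5≤p)
  where
  X = (p + 3) * (p + 5)
  h = p / 2
  factor : ∀ h → (1 + h * 2 + 3) * (1 + h * 2 + 5) ≡ (h + 2) * (h * 2 + 6) * 2
  factor = solve-∀
  X/2*2≡X : X / 2 * 2 ≡ X
  X/2*2≡X = m/n*n≡m (divides ((h + 2) * (h * 2 + 6))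
                      (trans (cong (λ q → (q + 3) * (q + 5)) (p≡r+h*2 p odd)) (factor h)))

ex-even : ∀ p → 1 ≤ p → p % 2 ≡ 0 → p ≢ 2 → p ≢ 6 → p ≢ 10 →
          IsEx (p + 6) (Book p) (1 + ((p + 2) * (p + 6)) / 2)
ex-even p 1≤p even p≢2 p≢6 p≢10 = isEx-Book p (1 + Y / 2) 2
  (≤-reflexive (trans (X≡Y+3 p) (cong (3 +_) (sym Y/2*2≡Y))))
  (trans (N²+2≡Y+2+4N p) (cong (λ z → 2 + z + (p + 6) * 4) (sym Y/2*2≡Y)))
  (construction-even p even 1≤p p≢2 p≢6 p≢10)
  where
  Y = (p + 2) * (p + 6)
  h = p / 2
  factor : ∀ h → (0 + h * 2 + 2) * (0 + h * 2 + 6) ≡ (h + 1) * (h * 2 + 6) * 2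
  factor = solve-∀
  Y/2*2≡Y : Y / 2 * 2 ≡ Y
  Y/2*2≡Y = m/n*n≡m (divides ((h + 1) * (h * 2 + 6))
                      (trans (cong (λ q → (q + 2) * (q + 6)) (p≡r+h*2 p even)) (factor h)))
  X≡Y+3 : ∀ p → (p + 3) * (p + 5) ≡ 3 + (p + 2) * (p + 6)
  X≡Y+3 = solve-∀
  N²+2≡Y+2+4N : ∀ p → (p + 6) * (p + 6) + 2 ≡ 2 + (p + 2) * (p + 6) + (p + 6) * 4
  N²+2≡Y+2+4N = solve-∀

theorem13 : (p : ℕ) → 1 ≤ p →
    ((p % 2 ≡ 1 → 5 ≤ p → IsEx (p + 6) (Book p) (((p + 3) * (p + 5)) / 2))
    × (p % 2 ≡ 0 → p ≢ 2 → p ≢ 6 → p ≢ 10 → IsEx (p + 6) (Book p) (1 + ((p + 2) * (p + 6)) / 2)))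
theorem13 p 1≤p = ex-odd p , ex-even p 1≤p
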